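{- Let $G$ be a finite simple connected graph with maximum degree $\Delta$, and let $k$ be a positive integer. If $k$ cops can capture the robber in the Cops and Robber game with a fast robber on $G$, then $k(\Delta+1)$ cops can capture the robber in the Helicopter Cops and Robber game (jump-searching version) on $G$.
   Context: Cops and Robber game with a fast robber: the cops first choose initial vertices (several may share a vertex), then the robber chooses a vertex. Players alternate rounds, cops first. Each cop stays or moves to an adjacent vertex; the robber may stay or move along any path from her current vertex containing no vertex occupied by a cop. The cops capture the robber if a cop moves onto her vertex. Helicopter Cops and Robber game (jump-searching version) with $k'$ cops: for $X \subseteq V(G)$, an $X$-flap is the vertex set of a connected component of $G - X$. Two sets $X, Y$ touch if $\overline{N}(X) \cap Y \neq \emptyset$, where $\overline{N}(X)$ is the set of vertices in $X$ or adjacent to a vertex of $X$. At the start the cops choose $X_0 \subseteq V(G)$ with $|X_0| \le k'$ and the robber chooses an $X_0$-flap $R_0$. In round $i$, given $(X_{i-1}, R_{i-1})$, the cops choose any $X_i \subseteq V(G)$ with $|X_i| \le k'$ and announce it; then the robber must choose an $X_i$-flap $R_i$ touching $R_{i-1}$. If this is impossible the cops have won (captured the robber); if the robber never runs out of valid moves she wins. -}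

module Defs where

open import Data.Nat using (ℕ; _≤_; _*_; _+_)
open import Data.Bool using (Bool; true; false)
open import Data.Fin using (Fin)
open import Data.Fin.Subset using (Subset; _∈_; _∉_; _⊆_; ∣_∣)
open import Data.Vec using (tabulate)
open import Data.Product using (Σ; ∃; ∃-syntax; _×_)
open import Data.Sum using (_⊎_)
open import Relation.Nullary using (¬_)
open import Relation.Binary.PropositionalEquality using (_≡_)

record Graph : Set where
  field
    n     : ℕ
    E     : Fin n → Fin n → Bool
    sym   : ∀ u v → E u v ≡ E v u
    irref : ∀ v → E v v ≡ false

module _ (G : Graph) where
  open Graph G

  Adj : Fin n → Fin n → Set
  Adj u v = E u v ≡ true

  data Walk (P : Fin n → Set) : Fin n → Fin n → Set where
    []  : ∀ {v} → P v → Walk P v v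
    _∷_ : ∀ {u w v} → P u × Adj u w → Walk P w v → Walk P u v

  deg : Fin n → ℕ
  deg v = ∣ tabulate (E v) ∣

  MaxDegree : ℕ → Set
  MaxDegree Δ = (∀ v → deg v ≤ Δ) × (∃[ v ] deg v ≡ Δ)

  -- connectedness of G (nonempty, any two vertices joined by a walk)
  Connected : Set
  Connected = Fin n × (∀ u v → Walk (λ _ → Data.Unit.⊤) u v)
    where import Data.Unit

  ConnectedIn : Subset n → Subset n → Set
  ConnectedIn X S = (∀ v → v ∈ S → v ∉ X)
                  × (∀ u v → u ∈ S → v ∈ S → Walk (_∈ S) u v)

  -- an X-flap: the vertex set of a connected component of G - X,
  -- i.e. a nonempty inclusion-maximal connected vertex set of G - X
  Flap : Subset n → Subset n → Set
  Flap X R = (∃[ v ] v ∈ R) × ConnectedIn X R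
           × (∀ S → R ⊆ S → ConnectedIn X S → S ⊆ R)

  InClosedNbhd : Subset n → Fin n → Set
  InClosedNbhd X v = v ∈ X ⊎ (∃[ u ] (u ∈ X × Adj u v))

  Touch : Subset n → Subset n → Set
  Touch X Y = ∃[ v ] (InClosedNbhd X v × v ∈ Y)

  -- Helicopter (jump-searching) game with k' cops.
  -- HeliWin k' X R : from position (X_{i-1}, R_{i-1}) = (X, R) the cops
  -- can force capture in finitely many rounds.
  data HeliWin (k' : ℕ) : Subset n → Subset n → Set where
    heli : ∀ {X R} (X' : Subset n) → ∣ X' ∣ ≤ k' →
           (∀ R' → Flap X' R' → Touch R' R → HeliWin k' X' R') →
           HeliWin k' X R

  HeliCopsWin : ℕ → Set
  HeliCopsWin k' = Σ (Subset n) λ X₀ → ∣ X₀ ∣ ≤ k' ×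
                   (∀ R₀ → Flap X₀ R₀ → HeliWin k' X₀ R₀)

  Occ : ∀ {k} → (Fin k → Fin n) → Fin n → Set
  Occ c v = ∃[ i ] c i ≡ v

  RobberMove : ∀ {k} → (Fin k → Fin n) → Fin n → Fin n → Set
  RobberMove c r r' = Walk (λ v → ¬ Occ c v) r r'

  -- FastWin k c r : cops at c, robber at r, cops to move; the cops can
  -- force capture in finitely many rounds.
  data FastWin (k : ℕ) : (Fin k → Fin n) → Fin n → Set where
    caught : ∀ {c r} → Occ c r → FastWin k c r
    move   : ∀ {c r} (c' : Fin k → Fin n) →
             (∀ i → c' i ≡ c i ⊎ Adj (c i) (c' i)) →
             (∀ r' → RobberMove c' r r' → FastWin k c' r') →
             FastWin k c r

  FastCopsWin : ℕ → Set
  FastCopsWin k = Σ (Fin k → Fin n) λ c₀ → ∀ r₀ → FastWin k c₀ r₀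

module Submission where

-- Whenever the fast cops
-- stand at positions c, the helicopter cops occupy the guard set Guard c: the union of the closed
-- neighbourhoods of the k positions, which has at most k(Δ+1) vertices.
-- The invariant maintained along a play is that the current helicopter
-- flap R is a connected vertex set avoiding Guard c and containing the
-- position r of an imagined fast robber.
--   * Capture: the fast cops catch r only if r ∈ Guard c, impossible.
--   * Move: the fast cops step c → c'.  Every new cop lies in N̄(c i), so
--     the old region R is free of cops c'.  A new flap R' touching R
--     provides a vertex v ∈ R with v ∈ R' or v adjacent to some u ∈ R'; the
--     fast robber runs inside R from r to v (and then to u), which is a
--     legal move, and the invariant holds again for R' and Guard c'.
-- Recursion along the (well-founded) fast-cop win yields a helicopter win.

open import Defs
open import Data.Nat using (ℕ; zero; suc; _≤_; _*_; _+_; z≤n; s≤s)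
open import Data.Nat.Properties
  using (≤-trans; ≤-reflexive; +-monoʳ-≤; +-mono-≤; n≤1+n; +-suc; +-comm; module ≤-Reasoning)
open import Data.Bool using (true; false)
open import Data.Fin using (Fin)
import Data.Fin as Fin
open import Data.Fin.Subset using (Subset; _∈_; _∉_; ∣_∣; _∪_; ⁅_⁆; ⊥)
open import Data.Fin.Subset.Properties using (x∈⁅x⁆; ∣⁅x⁆∣≡1; x∈p∪q⁺; ∣⊥∣≡0)
open import Data.Vec using (_∷_; []; tabulate)
open import Data.Vec.Properties using (lookup⇒[]=; lookup∘tabulate)
open import Data.Product using (∃-syntax; _×_; _,_)
open import Data.Sum using (_⊎_; inj₁; inj₂)
open import Data.Empty using (⊥-elim)
open import Relation.Nullary using (¬_)
open import Relation.Binary.PropositionalEquality using (_≡_; refl; trans; cong)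

∣p∪q∣≤∣p∣+∣q∣ : ∀ {n} (p q : Subset n) → ∣ p ∪ q ∣ ≤ ∣ p ∣ + ∣ q ∣
∣p∪q∣≤∣p∣+∣q∣ []          []          = z≤n
∣p∪q∣≤∣p∣+∣q∣ (true ∷ p)  (true ∷ q)  =
  s≤s (≤-trans (∣p∪q∣≤∣p∣+∣q∣ p q) (+-monoʳ-≤ ∣ p ∣ (n≤1+n ∣ q ∣)))
∣p∪q∣≤∣p∣+∣q∣ (true ∷ p)  (false ∷ q) = s≤s (∣p∪q∣≤∣p∣+∣q∣ p q)
∣p∪q∣≤∣p∣+∣q∣ (false ∷ p) (true ∷ q)  rewrite +-suc ∣ p ∣ ∣ q ∣ = s≤s (∣p∪q∣≤∣p∣+∣q∣ p q)
∣p∪q∣≤∣p∣+∣q∣ (false ∷ p) (false ∷ q) = ∣p∪q∣≤∣p∣+∣q∣ p q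

module _ (G : Graph) where
  open Graph G using (n; E)

  Walk-map : ∀ {P Q : Fin n → Set} → (∀ v → P v → Q v) →
             ∀ {a b} → Walk G P a b → Walk G Q a b
  Walk-map f ([] p)       = [] (f _ p)
  Walk-map f ((p , a) ∷ w) = (f _ p , a) ∷ Walk-map f w

  Walk-snoc : ∀ {P : Fin n → Set} {a b c} →
              Walk G P a b → Adj G b c → P c → Walk G P a c
  Walk-snoc ([] p)  bc pc = (p , bc) ∷ [] pc
  Walk-snoc (x ∷ w) bc pc = x ∷ Walk-snoc w bc pc

  N̄ : Fin n → Subset n
  N̄ v = ⁅ v ⁆ ∪ tabulate (E v)

  ∈N̄ : ∀ u w → w ≡ u ⊎ Adj G u w → w ∈ N̄ u
  ∈N̄ u w (inj₁ refl) = x∈p∪q⁺ (inj₁ (x∈⁅x⁆ w))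
  ∈N̄ u w (inj₂ uw)   = x∈p∪q⁺ (inj₂ (lookup⇒[]= w _ (trans (lookup∘tabulate (E u) w) uw)))

  ∣N̄∣≤Δ+1 : ∀ Δ → (∀ v → deg G v ≤ Δ) → ∀ v → ∣ N̄ v ∣ ≤ Δ + 1
  ∣N̄∣≤Δ+1 Δ degΔ v = begin
    ∣ ⁅ v ⁆ ∪ tabulate (E v) ∣      ≤⟨ ∣p∪q∣≤∣p∣+∣q∣ ⁅ v ⁆ (tabulate (E v)) ⟩
    ∣ ⁅ v ⁆ ∣ + deg G v             ≡⟨ cong (_+ deg G v) (∣⁅x⁆∣≡1 v) ⟩
    1 + deg G v                     ≤⟨ s≤s (degΔ v) ⟩
    1 + Δ                           ≡⟨ +-comm 1 Δ ⟩
    Δ + 1                           ∎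
    where open ≤-Reasoning

  Guard : ∀ k → (Fin k → Fin n) → Subset n
  Guard zero    c = ⊥
  Guard (suc k) c = N̄ (c Fin.zero) ∪ Guard k (λ i → c (Fin.suc i))

  N̄⊆Guard : ∀ k (c : Fin k → Fin n) i {w} → w ∈ N̄ (c i) → w ∈ Guard k c
  N̄⊆Guard (suc k) c Fin.zero    w∈ = x∈p∪q⁺ (inj₁ w∈)
  N̄⊆Guard (suc k) c (Fin.suc i) w∈ = x∈p∪q⁺ (inj₂ (N̄⊆Guard k (λ j → c (Fin.suc j)) i w∈))

  ∣Guard∣≤ : ∀ Δ → (∀ v → deg G v ≤ Δ) → ∀ k c → ∣ Guard k c ∣ ≤ k * (Δ + 1)
  ∣Guard∣≤ Δ degΔ zero    c = ≤-reflexive (∣⊥∣≡0 n)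
  ∣Guard∣≤ Δ degΔ (suc k) c =
    ≤-trans (∣p∪q∣≤∣p∣+∣q∣ (N̄ (c Fin.zero)) _)
            (+-mono-≤ (∣N̄∣≤Δ+1 Δ degΔ (c Fin.zero)) (∣Guard∣≤ Δ degΔ k _))

  Occ⇒Guard : ∀ k (c : Fin k → Fin n) {v} → Occ G c v → v ∈ Guard k c
  Occ⇒Guard k c (i , refl) = N̄⊆Guard k c i (∈N̄ (c i) (c i) (inj₁ refl))

  CopStep : ∀ {k} → (Fin k → Fin n) → (Fin k → Fin n) → Set
  CopStep c c' = ∀ i → c' i ≡ c i ⊎ Adj G (c i) (c' i)

  unguarded⇒free : ∀ k {c c' : Fin k → Fin n} → CopStep c c' →
                   ∀ {w} → w ∉ Guard k c → ¬ Occ G c' w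
  unguarded⇒free k {c} step w∉ (i , refl) = w∉ (N̄⊆Guard k c i (∈N̄ (c i) _ (step i)))

  escape : ∀ k {c c' : Fin k → Fin n} {r R R'} → CopStep c c' →
           r ∈ R → ConnectedIn G (Guard k c) R → ConnectedIn G (Guard k c') R' →
           Touch G R' R → ∃[ r' ] (r' ∈ R' × RobberMove G c' r r')
  escape k {c' = c'} {r} {R} {R'} step r∈R (R-avoids , R-conn) (R'-avoids , _) (v , v-near , v∈R) =
    reach v-near
    where
    free-in-R : ∀ w → w ∈ R → ¬ Occ G c' w
    free-in-R w w∈R = unguarded⇒free k step (R-avoids w w∈R)

    r⇝v : RobberMove G c' r v
    r⇝v = Walk-map free-in-R (R-conn r v r∈R v∈R)

    reach : InClosedNbhd G R' v → ∃[ r' ] (r' ∈ R' × RobberMove G c' r r')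
    reach (inj₁ v∈R')            = v , v∈R' , r⇝v
    reach (inj₂ (u , u∈R' , uv)) =
      u , u∈R' , Walk-snoc r⇝v (trans (Graph.sym G v u) uv)
                           (λ occ → R'-avoids u u∈R' (Occ⇒Guard k c' occ))

  simulate : ∀ k k' → (∀ c → ∣ Guard k c ∣ ≤ k') →
             ∀ {c r} → FastWin G k c r → ∀ X R → r ∈ R →
             ConnectedIn G (Guard k c) R → HeliWin G k' X R
  simulate k k' bound {c} {r} (caught occ) X R r∈R (R-avoids , _) =
    ⊥-elim (R-avoids r r∈R (Occ⇒Guard k c occ))
  simulate k k' bound (move c' step win) X R r∈R R-conn =
    heli (Guard k c') (bound c') next
    where
    next : ∀ R' → Flap G (Guard k c') R' → Touch G R' R → HeliWin G k' (Guard k c') R'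
    next R' (_ , R'-conn , _) touch with escape k step r∈R R-conn R'-conn touch
    ... | r' , r'∈R' , run = simulate k k' bound (win r' run) (Guard k c') R' r'∈R' R'-conn

lemma4p3 : (G : Graph) (Δ k : ℕ) → Connected G → MaxDegree G Δ → 1 ≤ k →
    FastCopsWin G k → HeliCopsWin G (k * (Δ + 1))
lemma4p3 G Δ k _ (degΔ , _) _ (c₀ , win) =
  Guard G k c₀ , bound c₀ , start
  where
  bound : ∀ c → ∣ Guard G k c ∣ ≤ k * (Δ + 1)
  bound = ∣Guard∣≤ G Δ degΔ k

  -- The robber's first flap is a connected region avoiding Guard c₀; the
  -- fast robber is imagined at any of its vertices.
  start : ∀ R₀ → Flap G (Guard G k c₀) R₀ → HeliWin G (k * (Δ + 1)) (Guard G k c₀) R₀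
  start R₀ ((r₀ , r₀∈R₀) , R₀-conn , _) =
    simulate G k (k * (Δ + 1)) bound (win r₀) (Guard G k c₀) R₀ r₀∈R₀ R₀-conn
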